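{- Let $\mathit{PTA}_1=(L_1,\overline{l_1},\chi,\Sigma,I_1,P_1)$ and $\mathit{PTA}_2=(L_2,\overline{l_2},\chi,\Sigma,I_2,P_2)$ be probabilistic timed automata with the same set of clocks $\chi$, the same set of labels $\Sigma$ and the same set of urgent labels $\Sigma^u\subseteq\Sigma$. If a state $(s,v)$ belonging to both semantic probabilistic systems $[[\mathit{PTA}_1]]$ and $[[\mathit{PTA}_2]]$ is a point of disagreement between $[[\mathit{PTA}_1]]$ and $[[\mathit{PTA}_2]]$, then $s$ is a point of disagreement between $\mathit{PTA}_1$ and $\mathit{PTA}_2$.
   Context: Clocks $\chi$ are non-negative variables; zones over $\chi$ are conjunctions of constraints $x\sim c$ and $x-y\sim c$ with $x,y\in\chi$, $\sim\in\{<,\le,>,\ge\}$, $c\in\mathbb{N}$. A clock valuation $v$ assigns values to all clocks; $v\triangleleft Y$ means $v$ satisfies zone $Y$; $v+t$ adds $t$ to every clock; $v[X:=0]$ resets the clocks in $X$ to $0$. A probabilistic timed automaton (PTA) is $(L,\overline{l},\chi,\Sigma,I,P)$ with finite location set $L$, initial location $\overline{l}$, clocks $\chi$, finite label set $\Sigma$ (with a distinguished subset $\Sigma^u$ of urgent labels), invariant map $I:L\to$ zones, and a finite set of probabilistic edges $P\subseteq L\times Z\times\Sigma\times\mathit{Dist}(2^\chi\times L)$ (source location, guard zone, label, distribution over pairs (set of clocks to reset, target location)). All locations are drawn from a common global set. Semantics (integer semantics): $[[\mathcal{T}]]$ is the probabilistic system whose states are pairs $(l,v)$ with $l\in L$ and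 $v\in\mathbb{N}^{|\chi|}$, $v\triangleleft I(l)$, start state $(\overline{l},0)$, actions $\mathbb{N}\cup\Sigma$, and $\mathit{Steps}(l,v)$ consisting of: (I) for each $t\in\mathbb{N}$, the pair $(t,\mu)$ with $\mu$ the point mass at $(l,v+t)$, provided $v+t'\triangleleft I(l)$ for all $0\le t'\le t$ and, for every edge $(l,g,\sigma,-)\in P$, if $v+t'\triangleleft g$ for some $0\le t'\le t$ then $\sigma\notin\Sigma^u$; (II) for each edge $(l,g,\sigma,p)\in P$ with $v\triangleleft g$, the pair $(\sigma,\mu)$ with $\mu(l',v')=\sum_{X\subseteq\chi,\ v'=v[X:=0]}p(X,l')$. A location $s\in L_1\cap L_2$ is a point of disagreement between $\mathit{PTA}_1$ and $\mathit{PTA}_2$ if $I_1(s)\ne I_2(s)$ or the sets of outgoing edges of $s$ differ, where two edges $(s,z,\sigma,p)$ are considered different if they differ in the guard $z$, the label $\sigma$, or the distribution $p$. For probabilistic systems with $\mathit{Steps}_1,\mathit{Steps}_2$, two distributions are equivalent if they have the same support and agree on it; two sets of labelled distributions are equivalent if every distribution in either set has an equivalent distribution in the other (labels ignored); a common state $x$ is a point of disagreement between the two systems if $\mathit{Steps}_1(x)$ and $\mathit{Steps}_2(x)$ are not equivalent.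
   Formalization: The distributions $p$ on the probabilistic edges of both PTAs, and the distributions of the semantic systems $[[\mathit{PTA}_1]]$ and $[[\mathit{PTA}_2]]$, take values in the rationals. -}

module Defs where

open import Data.Nat using (ℕ; zero; suc; _+_; _≤_; _<_; _≥_; _>_)
import Data.Nat as ℕ
open import Data.Integer using (ℤ; +_) renaming (_-_ to _-ℤ_; _≤_ to _≤ℤ_; _<_ to _<ℤ_; _≥_ to _≥ℤ_; _>_ to _>ℤ_)
open import Data.Rational using (ℚ; 0ℚ; 1ℚ) renaming (_+_ to _+ℚ_; _≤_ to _≤ℚ_)
open import Data.Fin using (Fin)
open import Data.Fin.Subset using (Subset; _∉_; inside; outside)
open import Data.Vec using (Vec; []; _∷_; lookup; tabulate)
import Data.Vec as Vec
open import Data.Vec.Properties using (≡-dec)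
open import Data.List using (List; []; _∷_; _++_; map; foldr)
open import Data.List.Membership.Propositional using (_∈_)
open import Data.List.Relation.Unary.Unique.Propositional using (Unique)
open import Data.Bool using (Bool; true; false; if_then_else_)
open import Data.Product using (Σ; _×_; _,_; ∃; ∃-syntax)
open import Data.Sum using (_⊎_)
open import Relation.Nullary using (¬_; does)
open import Relation.Binary.PropositionalEquality using (_≡_; _≢_)

Valuation : ℕ → Set
Valuation n = Vec ℕ n

_⊕_ : ∀ {n} → Valuation n → ℕ → Valuation n
v ⊕ t = Vec.map (λ x → x + t) v

reset : ∀ {n} → Valuation n → Subset n → Valuation n
reset v X = tabulate (λ i → if lookup X i then 0 else lookup v i)

data Cmp : Set where
  lt le gt ge : Cmp

data Constraint (n : ℕ) : Set where
  single : Fin n → Cmp → ℕ → Constraint n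
  diff   : Fin n → Fin n → Cmp → ℕ → Constraint n

Zone : ℕ → Set
Zone n = List (Constraint n)

cmpℕ : Cmp → ℕ → ℕ → Set
cmpℕ lt a b = a < b
cmpℕ le a b = a ≤ b
cmpℕ gt a b = a > b
cmpℕ ge a b = a ≥ b

cmpℤ : Cmp → ℤ → ℤ → Set
cmpℤ lt a b = a <ℤ b
cmpℤ le a b = a ≤ℤ b
cmpℤ gt a b = a >ℤ b
cmpℤ ge a b = a ≥ℤ b

satC : ∀ {n} → Valuation n → Constraint n → Set
satC v (single x ∼ c) = cmpℕ ∼ (lookup v x) c
satC v (diff x y ∼ c) = cmpℤ ∼ ((+ lookup v x) -ℤ (+ lookup v y)) (+ c)

data _◁_ {n} (v : Valuation n) : Zone n → Set where
  []  : v ◁ []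
  _∷_ : ∀ {c Y} → satC v c → v ◁ Y → v ◁ (c ∷ Y)

sumℚ : List ℚ → ℚ
sumℚ = foldr _+ℚ_ 0ℚ

allSubsets : (n : ℕ) → List (Subset n)
allSubsets zero    = [] ∷ []
allSubsets (suc n) = map (inside ∷_) (allSubsets n) ++ map (outside ∷_) (allSubsets n)

-- Distributions over 2^χ × Loc, represented as probability functions.
EdgeDist : ℕ → Set → Set
EdgeDist n Loc = Subset n → Loc → ℚ

record Edge (n k : ℕ) (Loc : Set) : Set where
  constructor edge
  field
    src   : Loc
    guard : Zone n
    label : Fin k
    dist  : EdgeDist n Loc

open Edge public

record PTA (n k : ℕ) (Loc : Set) : Set where
  field
    locs    : List Loc
    locsU   : Unique locs
    init    : Loc
    initIn  : init ∈ locs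
    inv     : Loc → Zone n
    edges   : List (Edge n k Loc)
    srcIn   : ∀ {e} → e ∈ edges → src e ∈ locs
    distNonneg : ∀ {e} → e ∈ edges → ∀ X l → 0ℚ ≤ℚ dist e X l
    distSupp   : ∀ {e} → e ∈ edges → ∀ X l → ¬ (l ∈ locs) → dist e X l ≡ 0ℚ
    distSum    : ∀ {e} → e ∈ edges →
                 sumℚ (map (λ X → sumℚ (map (λ l → dist e X l) locs)) (allSubsets n)) ≡ 1ℚ

open PTA public

-- Integer semantics [[T]] (w.r.t. the urgent label set U ⊆ Σ)

SemDist : ℕ → Set → Set
SemDist n Loc = Loc → Valuation n → ℚ

Action : ℕ → Set
Action k = ℕ ⊎ Fin k

IsState : ∀ {n k Loc} → PTA n k Loc → Loc → Valuation n → Set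
IsState T l v = (l ∈ locs T) × (v ◁ inv T l)

PointMass : ∀ {n Loc} → SemDist n Loc → Loc → Valuation n → Set
PointMass μ l w = (μ l w ≡ 1ℚ) × (∀ l' w' → ¬ ((l' ≡ l) × (w' ≡ w)) → μ l' w' ≡ 0ℚ)

EdgeInduced : ∀ {n Loc} → SemDist n Loc → Valuation n → EdgeDist n Loc → Set
EdgeInduced {n} μ v p =
  ∀ l' v' → μ l' v' ≡
    sumℚ (map (λ X → if does (≡-dec Data.Nat._≟_ v' (reset v X)) then p X l' else 0ℚ)
              (allSubsets n))

data Step {n k Loc} (U : Subset k) (T : PTA n k Loc) (l : Loc) (v : Valuation n)
          : Action k → SemDist n Loc → Set where
  timeStep : ∀ (t : ℕ) {μ} →
    (∀ t' → t' ≤ t → (v ⊕ t') ◁ inv T l) →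
    (∀ {e} → e ∈ edges T → src e ≡ l →
       (Σ ℕ λ t' → (t' ≤ t) × ((v ⊕ t') ◁ guard e)) → label e ∉ U) →
    PointMass μ l (v ⊕ t) →
    Step U T l v (Data.Sum.inj₁ t) μ
  edgeStep : ∀ {e μ} → e ∈ edges T → src e ≡ l → v ◁ guard e →
    EdgeInduced μ v (dist e) →
    Step U T l v (Data.Sum.inj₂ (label e)) μ

DistEquiv : ∀ {n Loc} → SemDist n Loc → SemDist n Loc → Set
DistEquiv μ μ' =
  (∀ l v → (μ l v ≢ 0ℚ → μ' l v ≢ 0ℚ) × (μ' l v ≢ 0ℚ → μ l v ≢ 0ℚ)) ×
  (∀ l v → μ l v ≢ 0ℚ → μ l v ≡ μ' l v)

StepsEquiv : ∀ {n k Loc} → Subset k → PTA n k Loc → PTA n k Loc → Loc → Valuation n → Set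
StepsEquiv U T₁ T₂ l v =
  (∀ {a μ} → Step U T₁ l v a μ → ∃[ a' ] ∃[ μ' ] (Step U T₂ l v a' μ' × DistEquiv μ μ')) ×
  (∀ {a μ} → Step U T₂ l v a μ → ∃[ a' ] ∃[ μ' ] (Step U T₁ l v a' μ' × DistEquiv μ μ'))

SemDisagree : ∀ {n k Loc} → Subset k → PTA n k Loc → PTA n k Loc → Loc → Valuation n → Set
SemDisagree U T₁ T₂ s v = IsState T₁ s v × IsState T₂ s v × ¬ StepsEquiv U T₁ T₂ s v

SameEdge : ∀ {n k Loc} → Edge n k Loc → Edge n k Loc → Set
SameEdge e e' = (guard e ≡ guard e') × (label e ≡ label e') × (∀ X l → dist e X l ≡ dist e' X l)

SameOutgoing : ∀ {n k Loc} → PTA n k Loc → PTA n k Loc → Loc → Set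
SameOutgoing T₁ T₂ s =
  (∀ {e} → e ∈ edges T₁ → src e ≡ s → Σ _ λ e' → (e' ∈ edges T₂) × (src e' ≡ s) × SameEdge e e') ×
  (∀ {e} → e ∈ edges T₂ → src e ≡ s → Σ _ λ e' → (e' ∈ edges T₁) × (src e' ≡ s) × SameEdge e e')

SynDisagree : ∀ {n k Loc} → PTA n k Loc → PTA n k Loc → Loc → Set
SynDisagree T₁ T₂ s =
  (s ∈ locs T₁) × (s ∈ locs T₂) × ((inv T₁ s ≢ inv T₂ s) ⊎ ¬ SameOutgoing T₁ T₂ s)

{-# OPTIONS --safe #-}
-- If s has the same invariant and the same outgoing edges in both automata, then
-- every step of (s, v) in one semantics is literally a step of the other, with the
-- same action and the same distribution, so the step sets are equivalent. Since
-- equality of zones is decidable, the contrapositive yields the required disjunction.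
module Submission where

open import Defs
open import Data.Nat using (ℕ)
open import Data.Fin.Subset using (Subset; _∉_)
open import Data.Vec using (Vec)
import Data.Nat as ℕ
import Data.Fin as Fin
open import Data.List using (foldr)
import Data.List.Properties as List
open import Data.List.Membership.Propositional using (_∈_)
open import Data.Product using (Σ; _×_; _,_; swap)
open import Data.Sum using (_⊎_; inj₁; inj₂)
open import Data.Bool using (if_then_else_)
open import Data.Rational using (0ℚ)
open import Relation.Nullary using (¬_; Dec; yes; no; does)
open import Relation.Nullary.Decidable using (map′; _×-dec_)
open import Relation.Binary.PropositionalEquality
  using (_≡_; _≢_; refl; sym; trans; cong; subst)
open import Data.Vec.Properties using (≡-dec)
open import Function using (id)

_≟-Cmp_ : (a b : Cmp) → Dec (a ≡ b)
lt ≟-Cmp lt = yes refl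
lt ≟-Cmp le = no λ ()
lt ≟-Cmp gt = no λ ()
lt ≟-Cmp ge = no λ ()
le ≟-Cmp lt = no λ ()
le ≟-Cmp le = yes refl
le ≟-Cmp gt = no λ ()
le ≟-Cmp ge = no λ ()
gt ≟-Cmp lt = no λ ()
gt ≟-Cmp le = no λ ()
gt ≟-Cmp gt = yes refl
gt ≟-Cmp ge = no λ ()
ge ≟-Cmp lt = no λ ()
ge ≟-Cmp le = no λ ()
ge ≟-Cmp gt = no λ ()
ge ≟-Cmp ge = yes refl

_≟-Constraint_ : ∀ {n} (a b : Constraint n) → Dec (a ≡ b)
single x ∼ c ≟-Constraint single y ∼′ d =
  map′ (λ { (refl , refl , refl) → refl }) (λ { refl → refl , refl , refl })
       (x Fin.≟ y ×-dec ∼ ≟-Cmp ∼′ ×-dec c ℕ.≟ d)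
diff x x′ ∼ c ≟-Constraint diff y y′ ∼′ d =
  map′ (λ { (refl , refl , refl , refl) → refl }) (λ { refl → refl , refl , refl , refl })
       (x Fin.≟ y ×-dec x′ Fin.≟ y′ ×-dec ∼ ≟-Cmp ∼′ ×-dec c ℕ.≟ d)
single _ _ _   ≟-Constraint diff _ _ _ _ = no λ ()
diff _ _ _ _   ≟-Constraint single _ _ _ = no λ ()

_≟-Zone_ : ∀ {n} (Y Z : Zone n) → Dec (Y ≡ Z)
_≟-Zone_ = List.≡-dec _≟-Constraint_

SameOutgoing-sym : ∀ {n k Loc} {T₁ T₂ : PTA n k Loc} {s : Loc} →
  SameOutgoing T₁ T₂ s → SameOutgoing T₂ T₁ s
SameOutgoing-sym = swap

DistEquiv-refl : ∀ {n Loc} (μ : SemDist n Loc) → DistEquiv μ μ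
DistEquiv-refl μ = (λ _ _ → id , id) , (λ _ _ _ → refl)

EdgeInduced-cong : ∀ {n Loc} {μ : SemDist n Loc} {v : Valuation n} {p q : EdgeDist n Loc} →
  (∀ X l → p X l ≡ q X l) → EdgeInduced μ v p → EdgeInduced μ v q
EdgeInduced-cong {n} {v = v} {p} {q} p≗q induced l′ v′ =
  trans (induced l′ v′) (cong (foldr _ _) (List.map-cong summand≗ (allSubsets n)))
  where
  summand≗ : ∀ X → (if does (≡-dec ℕ._≟_ v′ (reset v X)) then p X l′ else 0ℚ)
                 ≡ (if does (≡-dec ℕ._≟_ v′ (reset v X)) then q X l′ else 0ℚ)
  summand≗ X = cong (λ r → if does (≡-dec ℕ._≟_ v′ (reset v X)) then r else 0ℚ) (p≗q X l′)

Step-transfer : ∀ {n k Loc} {U : Subset k} {T₁ T₂ : PTA n k Loc} {s : Loc} {v : Valuation n}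
  {a : Action k} {μ : SemDist n Loc} →
  inv T₁ s ≡ inv T₂ s → SameOutgoing T₁ T₂ s →
  Step U T₁ s v a μ → Step U T₂ s v a μ
Step-transfer {U = U} {T₂ = T₂} {s} {v} inv≡ (_ , out₂⊆out₁) (timeStep t inInv notUrgent pointMass) =
  timeStep t (λ t′ t′≤t → subst ((v ⊕ t′) ◁_) inv≡ (inInv t′ t′≤t)) notUrgent₂ pointMass
  where
  notUrgent₂ : ∀ {e} → e ∈ edges T₂ → src e ≡ s →
    Σ ℕ (λ t′ → (t′ ℕ.≤ t) × ((v ⊕ t′) ◁ guard e)) → label e ∉ U
  notUrgent₂ e∈ src≡ (t′ , t′≤t , inGuard)
    with out₂⊆out₁ e∈ src≡
  ... | e′ , e′∈ , src′≡ , guard≡ , label≡ , _ =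
    subst (_∉ U) (sym label≡) (notUrgent e′∈ src′≡ (t′ , t′≤t , subst ((v ⊕ t′) ◁_) guard≡ inGuard))
Step-transfer {v = v} _ (out₁⊆out₂ , _) (edgeStep e∈ src≡ inGuard induced)
  with out₁⊆out₂ e∈ src≡
... | e′ , e′∈ , src′≡ , guard≡ , refl , dist≗ =
  edgeStep e′∈ src′≡ (subst (v ◁_) guard≡ inGuard) (EdgeInduced-cong {v = v} dist≗ induced)

StepsEquiv-from-same-location : ∀ {n k Loc} (U : Subset k) (T₁ T₂ : PTA n k Loc)
  (s : Loc) (v : Valuation n) →
  inv T₁ s ≡ inv T₂ s → SameOutgoing T₁ T₂ s → StepsEquiv U T₁ T₂ s v
StepsEquiv-from-same-location U T₁ T₂ s v inv≡ same =
  (λ {a} {μ} step → a , μ , Step-transfer inv≡ same step , DistEquiv-refl μ) ,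
  (λ {a} {μ} step → a , μ , Step-transfer (sym inv≡) same⁻¹ step , DistEquiv-refl μ)
  where
  same⁻¹ : SameOutgoing T₂ T₁ s
  same⁻¹ = SameOutgoing-sym {T₁ = T₁} {T₂} same

lemma1 : ∀ {n k : ℕ} {Loc : Set} (U : Subset k) (T₁ T₂ : PTA n k Loc) (s : Loc) (v : Vec ℕ n) →
    SemDisagree U T₁ T₂ s v → SynDisagree T₁ T₂ s
lemma1 U T₁ T₂ s v ((s∈₁ , _) , (s∈₂ , _) , ¬equiv) = s∈₁ , s∈₂ , differs
  where
  differs : (inv T₁ s ≢ inv T₂ s) ⊎ ¬ SameOutgoing T₁ T₂ s
  differs with inv T₁ s ≟-Zone inv T₂ s
  ... | no  inv≢ = inj₁ inv≢
  ... | yes inv≡ = inj₂ λ same → ¬equiv (StepsEquiv-from-same-location U T₁ T₂ s v inv≡ same)
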